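{- Let $\mathcal{G}$ be a maximal ancestral graph (MAG) and let $A_1(\mathcal{G})$ be the collection of subsets of $\mathcal{V}$ consisting of: (a) $\{v,w\}$ for every $v\in\mathcal{V}$ and $w\in\mathrm{pa}_{\mathcal{G}}(v)$; (b) $\{v,w,z\}$ for every $v\in\mathcal{V}$ and distinct $w,z\in\mathrm{pa}_{\mathcal{G}}(v)$ with $z$ not adjacent to $w$; (c) $\{v,w\}$ for every bidirected edge $v\leftrightarrow w$; (d) $\{v,w,z\}$ for every bidirected edge $v\leftrightarrow w$ and every $z\in T(v,w):=\big(\mathrm{dis}_{\mathrm{an}(\{v,w\})}(v)\cup\mathrm{pa}_{\mathcal{G}}(\mathrm{dis}_{\mathrm{an}(\{v,w\})}(v))\big)\setminus\{v,w\}$ such that $z$ is not adjacent to both $v$ and $w$; (e) $\{v,w,z\}$ for every bidirected edge $v\leftrightarrow w$ and every $z\in\big(\mathrm{sib}_{\mathcal{G}}(\mathrm{an}_{\mathcal{G}}(\{v,w\}))\cap\mathrm{dis}_{\mathcal{G}}(v)\big)\setminus\big(\mathrm{an}_{\mathcal{G}}(\{v,w\})\cup\mathrm{de}_{\mathcal{G}}(\{v,w\})\big)$ such that $z$ is not adjacent to both $v$ and $w$ and $z\in\mathrm{dis}_{\mathrm{an}(\{v,w,z\})}(v)$. Then $A_1(\mathcal{G})=\tilde{\mathcal{S}}_3(\mathcal{G})$.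
   Context: An acyclic directed mixed graph (ADMG) $\mathcal{G}$ on a finite vertex set $\mathcal{V}$ has directed ($a\to b$) and bidirected ($a\leftrightarrow b$) edges and no directed cycle. $\mathrm{pa}_{\mathcal{G}}(v)=\{w:w\to v\}$, $\mathrm{sib}_{\mathcal{G}}(v)=\{w:w\leftrightarrow v\}$, $\mathrm{an}_{\mathcal{G}}(v)$ ($\mathrm{de}_{\mathcal{G}}(v)$) is $v$ together with vertices having a directed path to (from) $v$, $\mathrm{dis}_{\mathcal{G}}(v)$ is $v$ together with vertices joined to $v$ by a path of bidirected edges; for sets take unions; $\mathrm{an}(\cdot)=\mathrm{an}_{\mathcal{G}}(\cdot)$. For $W\subseteq\mathcal{V}$, $\mathcal{G}_W$ is the induced subgraph and $\mathrm{dis}_W(\cdot)$ the district in $\mathcal{G}_W$. A path is a sequence of distinct vertices, consecutive ones joined by an edge; a non-endpoint $w$ is a collider if both path edges at $w$ have an arrowhead at $w$, else a noncollider. For $a,b\notin C$, a path between $a,b$ is m-connecting given $C$ if all noncolliders are outside $C$ and all colliders are in $\mathrm{an}_{\mathcal{G}}(C)$; $a,b$ are m-separated by $C$ if no such path exists. Vertices are adjacent if joined by an edge. $\mathcal{G}$ is maximal if each nonadjacent pair is m-separated by some set, ancestral if $\mathrm{sib}_{\mathcal{G}}(v)\cap\mathrm{an}_{\mathcal{G}}(v)=\emptyset$ for all $v$; a MAG is a maximal ancestral ADMG. $\mathrm{barren}_{\mathcal{G}}(W)=\{w\in W:\mathrm{de}_{\mathcal{G}}(w)\cap W=\{w\}\}$;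 a head is $H\subseteq\mathcal{V}$ with $\mathrm{barren}_{\mathcal{G}}(H)=H$ and $H$ contained in one district of $\mathcal{G}_{\mathrm{an}_{\mathcal{G}}(H)}$; $\mathrm{tail}(H)=(\mathrm{dis}_{\mathrm{an}(H)}(H)\setminus H)\cup\mathrm{pa}_{\mathcal{G}}(\mathrm{dis}_{\mathrm{an}(H)}(H))$; $\mathcal{S}(\mathcal{G})=\{H\cup A:H\text{ a head},\ A\subseteq\mathrm{tail}(H)\}$; $\mathcal{S}_3(\mathcal{G})=\{S\in\mathcal{S}(\mathcal{G}):2\le|S|\le3\}$; $\tilde{\mathcal{S}}_3(\mathcal{G})$ is the set of $S\in\mathcal{S}_3(\mathcal{G})$ in which the number of adjacent pairs of distinct vertices is 1 or 2. "$z$ is not adjacent to both $v$ and $w$" means it is not the case that $z$ is adjacent to $v$ and to $w$. (The set $A_1(\mathcal{G})$ is the output of the paper's Algorithm 1.) -}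

module Defs where

open import Data.Nat using (ℕ; _≤_; _<ᵇ_)
open import Data.Fin using (Fin; toℕ)
open import Data.Fin.Subset using (Subset; _∈_; _∉_; ⁅_⁆; _∪_; ∣_∣)
open import Data.Bool using (Bool; true; false; T; _∧_; _∨_; if_then_else_)
open import Data.List using (List; []; _∷_; map; allFin; cartesianProduct)
open import Data.Nat.ListAction using (sum)
open import Data.List.Relation.Unary.Unique.Propositional using (Unique)
open import Data.Product using (∃-syntax; _×_; _,_; proj₂)
open import Data.Sum using (_⊎_)
open import Data.Unit using (⊤)
open import Data.Vec using (lookup)
open import Relation.Nullary using (¬_)
open import Relation.Binary.PropositionalEquality using (_≡_; _≢_)
open import Relation.Binary.Construct.Closure.ReflexiveTransitive using (Star)

-- ADMGs on the vertex set Fin n.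
-- dir a b = true  means a directed edge a → b;
-- bi  a b = true  means a bidirected edge a ↔ b (symmetric, irreflexive).

record ADMG (n : ℕ) : Set where
  field
    dir       : Fin n → Fin n → Bool
    bi        : Fin n → Fin n → Bool
    bi-sym    : ∀ a b → bi a b ≡ bi b a
    bi-irrefl : ∀ a → bi a a ≡ false
    acyclic   : ∀ a b → T (dir a b) → ¬ Star (λ x y → T (dir x y)) b a

-- vertex sets that are not members of collections are predicates
VPred : ℕ → Set₁
VPred n = Fin n → Set

-- edge types used along a path from x to y: fwd = x → y, bwd = x ← y, bid = x ↔ y
data EdgeTy : Set where
  fwd bwd bid : EdgeTy

headAtTarget : EdgeTy → Bool
headAtTarget fwd = true
headAtTarget bwd = false
headAtTarget bid = true

headAtSource : EdgeTy → Bool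
headAtSource fwd = false
headAtSource bwd = true
headAtSource bid = true

module _ {n : ℕ} (G : ADMG n) where
  open ADMG G

  Dir : Fin n → Fin n → Set
  Dir a b = T (dir a b)

  Bi : Fin n → Fin n → Set
  Bi a b = T (bi a b)

  Adj : Fin n → Fin n → Set
  Adj a b = Dir a b ⊎ Dir b a ⊎ Bi a b

  adjᵇ : Fin n → Fin n → Bool
  adjᵇ a b = dir a b ∨ dir b a ∨ bi a b

  An : VPred n → VPred n
  An W x = ∃[ w ] (W w × Star Dir x w)

  De : VPred n → VPred n
  De W x = ∃[ w ] (W w × Star Dir w x)

  Pa : VPred n → VPred n
  Pa W x = ∃[ w ] (W w × Dir x w)

  Sib : VPred n → VPred n
  Sib W x = ∃[ w ] (W w × Bi x w)

  Dis : Fin n → VPred n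
  Dis v x = Star Bi v x

  BiIn : VPred n → Fin n → Fin n → Set
  BiIn W a b = W a × W b × Bi a b

  DisIn : VPred n → Fin n → VPred n
  DisIn W v x = Star (BiIn W) v x

  DisInSet : VPred n → VPred n → VPred n
  DisInSet W V x = ∃[ v ] (V v × DisIn W v x)

  HasEdge : Fin n → EdgeTy → Fin n → Set
  HasEdge x fwd y = Dir x y
  HasEdge x bwd y = Dir y x
  HasEdge x bid y = Bi x y

  -- a path starting at x is x together with a list of steps (edge type, next vertex)
  Steps : Fin n → List (EdgeTy × Fin n) → Set
  Steps x []             = ⊤
  Steps x ((e , y) ∷ r)  = HasEdge x e y × Steps y r

  endV : Fin n → List (EdgeTy × Fin n) → Fin n
  endV x []            = x
  endV x ((e , y) ∷ r) = endV y r

  pathVertices : Fin n → List (EdgeTy × Fin n) → List (Fin n)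
  pathVertices x r = x ∷ map proj₂ r

  AnS : Subset n → VPred n
  AnS C = An (_∈ C)

  -- condition on the non-endpoint vertices: x was reached by an edge of type e
  InnerOK : Subset n → EdgeTy → Fin n → List (EdgeTy × Fin n) → Set
  InnerOK C e x []             = ⊤
  InnerOK C e x ((e' , y) ∷ r) =
    (if headAtTarget e ∧ headAtSource e' then AnS C x else x ∉ C) × InnerOK C e' y r

  MConnOK : Subset n → Fin n → List (EdgeTy × Fin n) → Set
  MConnOK C a []            = ⊤
  MConnOK C a ((e , y) ∷ r) = InnerOK C e y r

  MConnecting : Fin n → Fin n → Subset n → Set
  MConnecting a b C = ∃[ r ] (Steps a r × endV a r ≡ b × Unique (pathVertices a r) × MConnOK C a r)

  MSeparated : Fin n → Fin n → Subset n → Set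
  MSeparated a b C = ¬ MConnecting a b C

  Maximal : Set
  Maximal = ∀ a b → a ≢ b → ¬ Adj a b → ∃[ C ] (a ∉ C × b ∉ C × MSeparated a b C)

  Ancestral : Set
  Ancestral = ∀ v w → Bi v w → ¬ Star Dir w v

  IsMAG : Set
  IsMAG = Maximal × Ancestral

  Barren : Subset n → Set
  Barren H = ∀ h h' → h ∈ H → h' ∈ H → Star Dir h h' → h ≡ h'

  OneDistrict : Subset n → Set
  OneDistrict H = ∀ h h' → h ∈ H → h' ∈ H → DisIn (An (_∈ H)) h h'

  IsHead : Subset n → Set
  IsHead H = Barren H × OneDistrict H

  Tail : Subset n → VPred n
  Tail H x = (DisInSet (An (_∈ H)) (_∈ H) x × x ∉ H)
           ⊎ Pa (DisInSet (An (_∈ H)) (_∈ H)) x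

  InS : Subset n → Set
  InS S = ∃[ H ] ∃[ A ] (IsHead H × (∀ x → x ∈ A → Tail H x) × S ≡ H ∪ A)

  adjPairs : Subset n → ℕ
  adjPairs S = sum (map f (cartesianProduct (allFin n) (allFin n)))
    where
    f : Fin n × Fin n → ℕ
    f (a , b) = if lookup S a ∧ lookup S b ∧ (toℕ a <ᵇ toℕ b) ∧ adjᵇ a b then 1 else 0

  InS3 : Subset n → Set
  InS3 S = InS S × 2 ≤ ∣ S ∣ × ∣ S ∣ ≤ 3

  InS̃3 : Subset n → Set
  InS̃3 S = InS3 S × (adjPairs S ≡ 1 ⊎ adjPairs S ≡ 2)

  pair : Fin n → Fin n → Subset n
  pair v w = ⁅ v ⁆ ∪ ⁅ w ⁆

  triple : Fin n → Fin n → Fin n → Subset n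
  triple v w z = ⁅ v ⁆ ∪ ⁅ w ⁆ ∪ ⁅ z ⁆

  two : Fin n → Fin n → VPred n
  two v w x = x ≡ v ⊎ x ≡ w

  three : Fin n → Fin n → Fin n → VPred n
  three v w z x = x ≡ v ⊎ x ≡ w ⊎ x ≡ z

  TSet : Fin n → Fin n → VPred n
  TSet v w z = (DisIn (An (two v w)) v z ⊎ Pa (DisIn (An (two v w)) v) z) × z ≢ v × z ≢ w

  A1a A1b A1c A1d A1e InA1 : Subset n → Set
  A1a S = ∃[ v ] ∃[ w ] (Dir w v × S ≡ pair v w)
  A1b S = ∃[ v ] ∃[ w ] ∃[ z ] (w ≢ z × Dir w v × Dir z v × ¬ Adj z w × S ≡ triple v w z)
  A1c S = ∃[ v ] ∃[ w ] (Bi v w × S ≡ pair v w)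
  A1d S = ∃[ v ] ∃[ w ] ∃[ z ] (Bi v w × TSet v w z × ¬ (Adj z v × Adj z w) × S ≡ triple v w z)
  A1e S = ∃[ v ] ∃[ w ] ∃[ z ]
            ( Bi v w
            × Sib (An (two v w)) z × Dis v z
            × ¬ An (two v w) z × ¬ De (two v w) z
            × ¬ (Adj z v × Adj z w)
            × DisIn (An (three v w z)) v z
            × S ≡ triple v w z)
  InA1 S = A1a S ⊎ A1b S ⊎ A1c S ⊎ A1d S ⊎ A1e S

module Submission where

-- The only graph-theoretic fact beyond unfolding definitions is the inducing-path
-- lemma: if distinct a, b lie in one district of G_{an({a,b})}, a simple
-- bidirected path between them can be rerouted, for any C, into an m-connecting
-- path given C, so by maximality a and b are adjacent.  The forward inclusion A₁ ⊆ S̃₃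
-- exhibits a head and a tail set for each of the five clauses (a)–(e).  The
-- backward inclusion splits on which vertices of S lie in its head: one head vertex
-- gives clauses (a)/(b), two give (c)/(d) (the inducing-path lemma makes the two
-- head vertices adjacent), three give (e).

open import Defs
open import Data.Nat using (ℕ; zero; suc; _+_; _≤_; _<_; _<ᵇ_; z≤n; s≤s)
open import Data.Nat.Properties using (+-commutativeSemigroup; +-identityʳ; <-asym; ≤-antisym; ≮⇒≥; <ᵇ⇒<; <⇒<ᵇ)
open import Data.Nat.ListAction using (sum)
open import Data.Nat.Tactic.RingSolver using (solve-∀)
open import Algebra.Properties.CommutativeSemigroup +-commutativeSemigroup using (x∙yz≈y∙xz)
open import Data.Fin using (Fin; zero; suc; toℕ; _≟_)
open import Data.Fin.Properties using (toℕ-injective)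
open import Data.Fin.Subset using (Subset; _∈_; _∉_; ⁅_⁆; _∪_; ∣_∣; ⊥)
open import Data.Fin.Subset.Properties using (_∈?_; x∈p∪q⁻; x∈p∪q⁺; x∈⁅x⁆; x∈⁅y⁆⇒x≡y; ∉⊥; ∪-assoc; ∪-identityʳ; ⊆-antisym)
open import Data.Bool using (Bool; true; false; T; _∧_; if_then_else_)
open import Data.Bool.Properties using (T-≡; T-∨; ¬-not) renaming (_≟_ to _≟ᵇ_)
open import Data.List using (List; []; _∷_; map; _++_; length; filter; allFin; cartesianProduct; tabulate)
open import Data.List.Properties using (map-++; map-∘; ++-identityʳ)
open import Data.Nat.ListAction.Properties using (sum-++)
open import Data.List.Relation.Unary.All using (All; []; _∷_)
import Data.List.Relation.Unary.All as All
open import Data.List.Relation.Unary.All.Properties using (¬Any⇒All¬)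
open import Data.List.Relation.Unary.Any using (here; there)
open import Data.List.Membership.Propositional using () renaming (_∈_ to _∈ₗ_; _∉_ to _∉ₗ_)
open import Data.List.Membership.Propositional.Properties using (∈-++⁻; ∈-filter⁺; ∈-filter⁻; ∈-allFin)
open import Data.List.Relation.Unary.Unique.Propositional using (Unique; []; _∷_)
open import Data.List.Relation.Unary.Unique.Propositional.Properties using (++⁺; filter⁺; allFin⁺)
open import Data.Vec using (lookup) renaming ([] to []ᵥ; _∷_ to _∷ᵥ_)
open import Data.Vec.Properties using ([]=⇒lookup; lookup⇒[]=)
open import Data.Product using (∃-syntax; Σ; _×_; _,_; proj₁; proj₂)
open import Data.Sum using (_⊎_; inj₁; inj₂; [_,_])
import Data.Sum as Sum
open import Data.Unit using (tt)
open import Data.Empty using () renaming (⊥ to Empty; ⊥-elim to absurd)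
open import Function using (_∘_)
open import Function.Bundles using (_⇔_; mk⇔; Equivalence)
open import Relation.Nullary using (¬_; Dec; yes; no; does)
open import Relation.Nullary.Decidable using (dec-false; map′)
open import Relation.Binary.Definitions using (DecidableEquality)
open import Relation.Binary.PropositionalEquality using (_≡_; _≢_; refl; sym; trans; cong; cong₂; subst; ≢-sym; module ≡-Reasoning)
open import Relation.Binary.Construct.Closure.ReflexiveTransitive using (Star; ε; _◅_; _◅◅_) renaming (reverse to reverseStar)

byCases : (P : Set) → (P ⊎ ¬ P → Empty) → Empty
byCases P k = k (inj₂ (λ p → k (inj₁ p)))

-- Simple walks: any walk can be shortened to one without repeated vertices.

module SimpleWalk {A : Set} (_≟ᴬ_ : DecidableEquality A) (R : A → A → Set) where
  open import Data.List.Membership.DecPropositional _≟ᴬ_ using () renaming (_∈?_ to _∈ₗ?_)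

  visited : ∀ {x y} → Star R x y → List A
  visited ε = []
  visited (_◅_ {j = j} _ p) = j ∷ visited p

  suffixFrom : ∀ {x j y} (p : Star R j y) → Unique (j ∷ visited p) → x ∈ₗ (j ∷ visited p) →
               Σ (Star R x y) (λ q → Unique (x ∷ visited q))
  suffixFrom p u (here refl) = p , u
  suffixFrom ε u (there ())
  suffixFrom (_ ◅ p) (_ ∷ u) (there m) = suffixFrom p u m

  simplify : ∀ {x y} → Star R x y → Σ (Star R x y) (λ q → Unique (x ∷ visited q))
  simplify ε = ε , [] ∷ []
  simplify {x} (_◅_ {j = j} r p) with simplify p
  ... | p' , u with x ∈ₗ? (j ∷ visited p')
  ... | yes m = suffixFrom p' u m
  ... | no x∉ = (r ◅ p') , (¬Any⇒All¬ _ x∉ ∷ u)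

module PathSteps {n : ℕ} (G : ADMG n) where
  open ADMG G

  Route : Set
  Route = List (EdgeTy × Fin n)

  Edge : EdgeTy → Fin n → Fin n → Set
  Edge e x y = HasEdge G x e y

  stepsOf : ∀ (e : EdgeTy) {x y} → Star (Edge e) x y → Route
  stepsOf e ε = []
  stepsOf e (_◅_ {j = j} _ p) = (e , j) ∷ stepsOf e p

  stepsOf-valid : ∀ e {x y} (p : Star (Edge e) x y) → Steps G x (stepsOf e p)
  stepsOf-valid e ε = tt
  stepsOf-valid e (r ◅ p) = r , stepsOf-valid e p

  stepsOf-end : ∀ e {x y} (p : Star (Edge e) x y) → endV G x (stepsOf e p) ≡ y
  stepsOf-end e ε = refl
  stepsOf-end e (r ◅ p) = stepsOf-end e p

  stepsOf-from : ∀ e {x y} (p : Star (Edge e) x y) → All (Star (Edge e) x) (pathVertices G x (stepsOf e p))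
  stepsOf-from e ε = ε ∷ []
  stepsOf-from e (r ◅ p) = ε ∷ All.map (r ◅_) (stepsOf-from e p)

  stepsOf-to : ∀ e {x y} (p : Star (Edge e) x y) → All (λ t → Star (Edge e) t y) (pathVertices G x (stepsOf e p))
  stepsOf-to e ε = ε ∷ []
  stepsOf-to e (r ◅ p) = (r ◅ p) ∷ stepsOf-to e p

  stepsOf-unique : ∀ e → (∀ {u v} → Edge e u v → ¬ Star (Edge e) v u) →
                   ∀ {x y} (p : Star (Edge e) x y) → Unique (pathVertices G x (stepsOf e p))
  stepsOf-unique e acyc ε = [] ∷ []
  stepsOf-unique e acyc {x} (_◅_ {j = j} r p) = fresh (stepsOf-from e p) ∷ stepsOf-unique e acyc p
    where
    fresh : ∀ {xs} → All (Star (Edge e) j) xs → All (x ≢_) xs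
    fresh [] = []
    fresh (s ∷ ss) = (λ { refl → acyc r s }) ∷ fresh ss

  reverseBwd : ∀ {u v} → Star (Edge bwd) u v → Star (Edge fwd) v u
  reverseBwd = reverseStar (λ r → r)

  reverseFwd : ∀ {u v} → Star (Edge fwd) u v → Star (Edge bwd) v u
  reverseFwd = reverseStar (λ r → r)

  fwd-acyclic : ∀ {u v} → Edge fwd u v → ¬ Star (Edge fwd) v u
  fwd-acyclic {u} {v} r s = acyclic u v r s

  bwd-acyclic : ∀ {u v} → Edge bwd u v → ¬ Star (Edge bwd) v u
  bwd-acyclic {u} {v} r s = acyclic v u r (reverseBwd s)

  steps-++ : ∀ a ρ σ {x} → Steps G a ρ → endV G a ρ ≡ x → Steps G x σ → Steps G a (ρ ++ σ)
  steps-++ a [] σ _ refl t = t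
  steps-++ a ((e , y) ∷ ρ) σ (h , s) e≡ t = h , steps-++ y ρ σ s e≡ t

  endV-++ : ∀ a ρ σ {x} → endV G a ρ ≡ x → endV G a (ρ ++ σ) ≡ endV G x σ
  endV-++ a [] σ refl = refl
  endV-++ a ((e , y) ∷ ρ) σ e≡ = endV-++ y ρ σ e≡

  unique-++ : ∀ a ρ σ → Unique (pathVertices G a ρ) → Unique (map proj₂ σ) →
              (∀ {t} → ¬ (t ∈ₗ pathVertices G a ρ × t ∈ₗ map proj₂ σ)) →
              Unique (pathVertices G a (ρ ++ σ))
  unique-++ a ρ σ uρ uσ disjoint =
    subst Unique (cong (a ∷_) (sym (map-++ proj₂ ρ σ))) (++⁺ uρ uσ disjoint)

  ∈-++-split : ∀ a ρ σ {t} → t ∈ₗ pathVertices G a (ρ ++ σ) → t ∈ₗ pathVertices G a ρ ⊎ t ∈ₗ map proj₂ σ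
  ∈-++-split a ρ σ {t} m = ∈-++⁻ (pathVertices G a ρ) (subst (t ∈ₗ_) (cong (a ∷_) (map-++ proj₂ ρ σ)) m)

-- Inducing paths.  Let a ↔ y₁ ↔ … ↔ b be a simple bidirected path all of whose
-- vertices are ancestors of a or b.  For every C we build an m-connecting path
-- between a and b given C: bidirected steps are kept while they enter an(C)
-- (colliders in an(C)); at the first vertex y outside an(C) we either finish with
-- a directed path y → … → b, or (y is then an ancestor of a) restart from a along
-- a ← … ← y.

module InducingPath {n : ℕ} (G : ADMG n) (C : Subset n) (a b : Fin n) where
  open ADMG G
  open PathSteps G

  AnC : Fin n → Set
  AnC = AnS G C

  data DirRun : Route → Set where
    dnil : DirRun []
    dcons : ∀ {t ρ} → t ∉ C → DirRun ρ → DirRun ((fwd , t) ∷ ρ)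

  data ColRun : Route → Set where
    cnil : ColRun []
    clast : ∀ {y ρ} → y ∉ C → DirRun ρ → ColRun ((bid , y) ∷ ρ)
    ccons : ∀ {y ρ} → AnC y → ColRun ρ → ColRun ((bid , y) ∷ ρ)

  data Shape : Route → Set where
    viaDir : ∀ {ρ} → DirRun ρ → Shape ρ
    viaCol : ∀ {ρ} → ColRun ρ → Shape ρ
    back : ∀ {t ρ} → t ∉ C → Shape ρ → Shape ((bwd , t) ∷ ρ)

  dirRun-ok : ∀ e x {ρ} → x ∉ C → DirRun ρ → InnerOK G C e x ρ
  dirRun-ok e x x∉ dnil = tt
  dirRun-ok fwd x x∉ (dcons {t} t∉ r) = x∉ , dirRun-ok fwd t t∉ r
  dirRun-ok bwd x x∉ (dcons {t} t∉ r) = x∉ , dirRun-ok fwd t t∉ r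
  dirRun-ok bid x x∉ (dcons {t} t∉ r) = x∉ , dirRun-ok fwd t t∉ r

  colRun-ok : ∀ x {ρ} → AnC x → ColRun ρ → InnerOK G C bid x ρ
  colRun-ok x ax cnil = tt
  colRun-ok x ax (clast {y} y∉ r) = ax , dirRun-ok bid y y∉ r
  colRun-ok x ax (ccons {y} ay r) = ax , colRun-ok y ay r

  shape-ok : ∀ x {ρ} → x ∉ C → Shape ρ → InnerOK G C bwd x ρ
  shape-ok x x∉ (viaDir r) = dirRun-ok bwd x x∉ r
  shape-ok x x∉ (viaCol cnil) = tt
  shape-ok x x∉ (viaCol (clast {y} y∉ r)) = x∉ , dirRun-ok bid y y∉ r
  shape-ok x x∉ (viaCol (ccons {y} ay r)) = x∉ , colRun-ok y ay r
  shape-ok x x∉ (back {t} t∉ s) = x∉ , shape-ok t t∉ s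

  shape-mconn : ∀ {ρ} → Shape ρ → MConnOK G C a ρ
  shape-mconn (viaDir dnil) = tt
  shape-mconn (viaDir (dcons {t} t∉ r)) = dirRun-ok fwd t t∉ r
  shape-mconn (viaCol cnil) = tt
  shape-mconn (viaCol (clast {y} y∉ r)) = dirRun-ok bid y y∉ r
  shape-mconn (viaCol (ccons {y} ay r)) = colRun-ok y ay r
  shape-mconn (back {t} t∉ s) = shape-ok t t∉ s

  data ColPrefix : Route → Set where
    pnil : ColPrefix []
    pcons : ∀ {y ρ} → AnC y → ColPrefix ρ → ColPrefix ((bid , y) ∷ ρ)

  Avoids : Fin n → Set
  Avoids t = ¬ AnC t × ¬ Star (Dir G) t b

  data Prefix : Route → Set where
    fromCol : ∀ {ρ} → ColPrefix ρ → Prefix ρ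
    pback : ∀ {t ρ} → Avoids t → Prefix ρ → Prefix ((bwd , t) ∷ ρ)

  ¬AnC⇒∉ : ∀ {t} → ¬ AnC t → t ∉ C
  ¬AnC⇒∉ na m = na (_ , m , ε)

  AnC-back : ∀ {u v} → Star (Dir G) u v → AnC v → AnC u
  AnC-back s (c , m , s') = c , m , (s ◅◅ s')

  colPrefix-++ : ∀ {ρ σ} → ColPrefix ρ → ColRun σ → ColRun (ρ ++ σ)
  colPrefix-++ pnil r = r
  colPrefix-++ (pcons ay p) r = ccons ay (colPrefix-++ p r)

  prefix-++ : ∀ {ρ σ} → Prefix ρ → ColRun σ → Shape (ρ ++ σ)
  prefix-++ (fromCol p) r = viaCol (colPrefix-++ p r)
  prefix-++ (pback (na , _) p) r = back (¬AnC⇒∉ na) (prefix-++ p r)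

  colPrefix-snoc : ∀ {ρ y} → ColPrefix ρ → AnC y → ColPrefix (ρ ++ (bid , y) ∷ [])
  colPrefix-snoc pnil ay = pcons ay pnil
  colPrefix-snoc (pcons a' p) ay = pcons a' (colPrefix-snoc p ay)

  prefix-snoc : ∀ {ρ y} → Prefix ρ → AnC y → Prefix (ρ ++ (bid , y) ∷ [])
  prefix-snoc (fromCol p) ay = fromCol (colPrefix-snoc p ay)
  prefix-snoc (pback nb p) ay = pback nb (prefix-snoc p ay)

  -- every vertex of a prefix is in an(C) or not an ancestor of b
  -- (so no directed path from a vertex outside an(C) to b meets the prefix)
  Separable : Fin n → Set
  Separable t = AnC t ⊎ ¬ Star (Dir G) t b

  prefix-separable : ∀ {ρ} → Prefix ρ → All Separable (map proj₂ ρ)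
  prefix-separable (fromCol p) = col p
    where
    col : ∀ {ρ} → ColPrefix ρ → All Separable (map proj₂ ρ)
    col pnil = []
    col (pcons ay p) = inj₁ ay ∷ col p
  prefix-separable (pback (_ , nb) p) = inj₂ nb ∷ prefix-separable p

  dirRun-outside : ∀ {u v} (p : Star (Dir G) u v) → ¬ AnC u → DirRun (stepsOf fwd p)
  dirRun-outside ε na = dnil
  dirRun-outside (r ◅ p) na = dcons (¬AnC⇒∉ naj) (dirRun-outside p naj)
    where naj = λ aj → na (AnC-back (r ◅ ε) aj)

  W : Fin n → Set
  W = An G (two G a b)

  open SimpleWalk _≟_ (BiIn G W)

  module Search (sep : MSeparated G a b C) where

    -- restart from a along a ← … ← y, where y ∈ an(a) is neither in an(C) nor in an(b)
    restart : ∀ {y} → ¬ AnC y → ¬ Star (Dir G) y b → W y → (p : Star (BiIn G W) y b) →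
              Unique (y ∷ visited p) → Empty

    -- Invariant: ρ is a valid prefix path from a to x, and the remaining bidirected
    -- path p from x to b shares no an(C)-vertex with ρ.  At the next vertex y of p:
    -- if y ∈ an(C) it becomes a collider of ρ; if y ⇝ b we finish along y → … → b;
    -- otherwise y ∈ an(a) and we restart.
    go : ∀ {x} (p : Star (BiIn G W) x b) → Unique (x ∷ visited p) →
         (ρ : Route) → Steps G a ρ → endV G a ρ ≡ x →
         Unique (pathVertices G a ρ) → Prefix ρ → Separable a →
         (∀ {y} → y ∈ₗ visited p → AnC y → y ∉ₗ pathVertices G a ρ) → Empty
    go ε u ρ st end uq pre sa fresh =
      sep (ρ , st , end , uq , shape-mconn (subst Shape (++-identityʳ ρ) (prefix-++ pre cnil)))
    go {x} (_◅_ {j = y} (_ , Wy , x↔y) p) (_ ∷ u) ρ st end uq pre sa fresh =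
      byCases (AnC y) λ where
        (inj₁ ay) → go p u (ρ ++ (bid , y) ∷ [])
                       (steps-++ a ρ _ st end (x↔y , tt))
                       (endV-++ a ρ _ end)
                       (unique-++ a ρ _ uq ([] ∷ []) (λ { (m , here refl) → fresh (here refl) ay m }))
                       (prefix-snoc pre ay) sa (fresh′ ay)
        (inj₂ nay) → byCases (Star (Dir G) y b) λ where
          (inj₁ y⇝b) → sep ( ρ ++ (bid , y) ∷ stepsOf fwd y⇝b
                           , steps-++ a ρ _ st end (x↔y , stepsOf-valid fwd y⇝b)
                           , trans (endV-++ a ρ _ end) (stepsOf-end fwd y⇝b)
                           , unique-++ a ρ _ uq (stepsOf-unique fwd fwd-acyclic y⇝b) (disjoint nay y⇝b)
                           , shape-mconn (prefix-++ pre (clast (¬AnC⇒∉ nay) (dirRun-outside y⇝b nay))))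
          (inj₂ ny⇝b) → restart nay ny⇝b Wy p u
      where
      fresh′ : AnC y → ∀ {y'} → y' ∈ₗ visited p → AnC y' → y' ∉ₗ pathVertices G a (ρ ++ (bid , y) ∷ [])
      fresh′ ay {y'} m ay' m' with ∈-++-split a ρ _ m'
      ... | inj₁ m₁ = fresh (there m) ay' m₁
      ... | inj₂ (here refl) = All.lookup (distinctFromRest u) m refl
        where
        distinctFromRest : ∀ {z zs} → Unique (z ∷ zs) → All (z ≢_) zs
        distinctFromRest (z∉zs ∷ _) = z∉zs
      disjoint : ¬ AnC y → (y⇝b : Star (Dir G) y b) →
                 ∀ {t} → ¬ (t ∈ₗ pathVertices G a ρ × t ∈ₗ pathVertices G y (stepsOf fwd y⇝b))
      disjoint nay y⇝b (m₁ , m₂) with All.lookup (sa ∷ prefix-separable pre) m₁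
      ... | inj₁ at = nay (AnC-back (All.lookup (stepsOf-from fwd y⇝b) m₂) at)
      ... | inj₂ nb = nb (All.lookup (stepsOf-to fwd y⇝b) m₂)

    restart nay ny⇝b (w , inj₂ refl , y⇝b) p u = ny⇝b y⇝b
    restart {y} nay ny⇝b (w , inj₁ refl , y⇝a) p u =
      go p u (stepsOf bwd a⇜y) (stepsOf-valid bwd a⇜y) (stepsOf-end bwd a⇜y)
         (stepsOf-unique bwd bwd-acyclic a⇜y) (backPrefix a⇜y)
         (inj₂ (λ a⇝b → ny⇝b (y⇝a ◅◅ a⇝b))) fresh
      where
      a⇜y = reverseFwd y⇝a
      backPrefix : ∀ {u} (q : Star (Edge bwd) u y) → Prefix (stepsOf bwd q)
      backPrefix ε = fromCol pnil
      backPrefix (r ◅ q) = pback ((λ aj → nay (AnC-back (reverseBwd q) aj)) , (λ jb → ny⇝b (reverseBwd q ◅◅ jb)))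
                                 (backPrefix q)
      fresh : ∀ {y'} → y' ∈ₗ visited p → AnC y' → y' ∉ₗ pathVertices G a (stepsOf bwd a⇜y)
      fresh m ay' m' = nay (AnC-back (reverseBwd (All.lookup (stepsOf-to bwd a⇜y) m')) ay')

  not-separated : MSeparated G a b C → Σ (Star (BiIn G W) a b) (λ q → Unique (a ∷ visited q)) → Empty
  not-separated sep (p , u) = byCases (AnC a) λ where
      (inj₁ aa) → Search.go sep p u [] tt refl ([] ∷ []) (fromCol pnil) (inj₁ aa) (fresh₀ u)
      (inj₂ na) → byCases (Star (Dir G) a b) λ where
        (inj₁ a⇝b) → sep ( stepsOf fwd a⇝b , stepsOf-valid fwd a⇝b , stepsOf-end fwd a⇝b
                         , stepsOf-unique fwd fwd-acyclic a⇝b , shape-mconn (viaDir (dirRun-outside a⇝b na)))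
        (inj₂ na⇝b) → Search.go sep p u [] tt refl ([] ∷ []) (fromCol pnil) (inj₂ na⇝b) (fresh₀ u)
    where
    fresh₀ : Unique (a ∷ visited p) → ∀ {y} → y ∈ₗ visited p → AnC y → y ∉ₗ pathVertices G a []
    fresh₀ (a∉p ∷ _) m ay (here refl) = All.lookup a∉p m refl

co-district⇒adjacent : ∀ {n} (G : ADMG n) → Maximal G → ∀ {a b} → a ≢ b →
                       DisIn G (An G (two G a b)) a b → ¬ ¬ Adj G a b
co-district⇒adjacent G maximal {a} {b} a≢b d ¬adj with maximal a b a≢b ¬adj
... | C , _ , _ , sep = InducingPath.not-separated G C a b sep (SimpleWalk.simplify _≟_ _ d)

-- Finite sums over Fin n, and the cardinality of an enumerated subset.

ΣF : ∀ {n} → (Fin n → ℕ) → ℕ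
ΣF {zero} f = 0
ΣF {suc n} f = f zero + ΣF (f ∘ suc)

ΣL : ∀ {n} → List (Fin n) → (Fin n → ℕ) → ℕ
ΣL L f = sum (map f L)

ΣF-cong : ∀ {n} {f g : Fin n → ℕ} → (∀ i → f i ≡ g i) → ΣF f ≡ ΣF g
ΣF-cong {zero} h = refl
ΣF-cong {suc n} h = cong₂ _+_ (h zero) (ΣF-cong (h ∘ suc))

ΣF-zero : ∀ {n} {f : Fin n → ℕ} → (∀ i → f i ≡ 0) → ΣF f ≡ 0
ΣF-zero {zero} h = refl
ΣF-zero {suc n} h rewrite h zero = ΣF-zero (h ∘ suc)

ΣL-cong : ∀ {n} (L : List (Fin n)) {f g : Fin n → ℕ} → (∀ {i} → i ∈ₗ L → f i ≡ g i) → ΣL L f ≡ ΣL L g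
ΣL-cong [] h = refl
ΣL-cong (x ∷ L) h = cong₂ _+_ (h (here refl)) (ΣL-cong L (h ∘ there))

ΣL-ones : ∀ {n} (L : List (Fin n)) → ΣL L (λ _ → 1) ≡ length L
ΣL-ones [] = refl
ΣL-ones (x ∷ L) = cong suc (ΣL-ones L)

erase : ∀ {n} → (Fin n → ℕ) → Fin n → Fin n → ℕ
erase f p i = if does (i ≟ p) then 0 else f i

ΣF-erase : ∀ {n} (f : Fin n → ℕ) p → ΣF f ≡ f p + ΣF (erase f p)
ΣF-erase {suc n} f zero = refl
ΣF-erase {suc n} f (suc q) = begin
    f zero + ΣF (f ∘ suc)                          ≡⟨ cong (f zero +_) (ΣF-erase (f ∘ suc) q) ⟩
    f zero + (f (suc q) + ΣF (erase (f ∘ suc) q))  ≡⟨ x∙yz≈y∙xz (f zero) (f (suc q)) _ ⟩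
    f (suc q) + (f zero + ΣF (erase (f ∘ suc) q))  ∎
  where open ≡-Reasoning

ΣF-support : ∀ {n} (L : List (Fin n)) (f : Fin n → ℕ) → Unique L → (∀ i → i ∉ₗ L → f i ≡ 0) →
             ΣF f ≡ ΣL L f
ΣF-support [] f _ h = ΣF-zero (λ i → h i (λ ()))
ΣF-support (x ∷ L) f (x∉L ∷ u) h = begin
    ΣF f                    ≡⟨ ΣF-erase f x ⟩
    f x + ΣF (erase f x)    ≡⟨ cong (f x +_) (ΣF-support L (erase f x) u vanish) ⟩
    f x + ΣL L (erase f x)  ≡⟨ cong (f x +_) (ΣL-cong L keep) ⟩
    f x + ΣL L f            ∎
  where
  open ≡-Reasoning
  vanish : ∀ i → i ∉ₗ L → erase f x i ≡ 0
  vanish i i∉L with i ≟ x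
  ... | yes _ = refl
  ... | no i≢x = h i λ { (here i≡x) → i≢x i≡x ; (there m) → i∉L m }
  keep : ∀ {i} → i ∈ₗ L → erase f x i ≡ f i
  keep {i} m rewrite dec-false (i ≟ x) (λ i≡x → All.lookup x∉L m (sym i≡x)) = refl

sum-tabulate : ∀ {n} {B : Set} (g : B → ℕ) (h : Fin n → B) → sum (map g (tabulate h)) ≡ ΣF (g ∘ h)
sum-tabulate {zero} g h = refl
sum-tabulate {suc n} g h = cong (g (h zero) +_) (sum-tabulate g (h ∘ suc))

sum-cartesianProduct : ∀ {A B : Set} (f : A × B → ℕ) xs ys →
  sum (map f (cartesianProduct xs ys)) ≡ sum (map (λ x → sum (map (λ y → f (x , y)) ys)) xs)
sum-cartesianProduct f [] ys = refl
sum-cartesianProduct f (x ∷ xs) ys = begin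
    sum (map f (map (x ,_) ys ++ cartesianProduct xs ys))
      ≡⟨ cong sum (map-++ f (map (x ,_) ys) _) ⟩
    sum (map f (map (x ,_) ys) ++ map f (cartesianProduct xs ys))
      ≡⟨ sum-++ (map f (map (x ,_) ys)) _ ⟩
    sum (map f (map (x ,_) ys)) + sum (map f (cartesianProduct xs ys))
      ≡⟨ cong₂ _+_ (cong sum (sym (map-∘ ys))) (sum-cartesianProduct f xs ys) ⟩
    sum (map (λ y → f (x , y)) ys) + sum (map (λ x → sum (map (λ y → f (x , y)) ys)) xs)  ∎
  where open ≡-Reasoning

ΣF-allPairs : ∀ {n} (f : Fin n × Fin n → ℕ) →
              sum (map f (cartesianProduct (allFin n) (allFin n))) ≡ ΣF (λ a → ΣF (λ b → f (a , b)))
ΣF-allPairs {n} f = trans (sum-cartesianProduct f (allFin n) (allFin n))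
  (trans (sum-tabulate (λ x → sum (map (λ y → f (x , y)) (allFin n))) (λ i → i))
         (ΣF-cong (λ a → sum-tabulate (λ y → f (a , y)) (λ i → i))))

ind : Bool → ℕ
ind b = if b then 1 else 0

∣p∣≡ΣF : ∀ {n} (p : Subset n) → ∣ p ∣ ≡ ΣF (ind ∘ lookup p)
∣p∣≡ΣF []ᵥ = refl
∣p∣≡ΣF (true ∷ᵥ p) = cong suc (∣p∣≡ΣF p)
∣p∣≡ΣF (false ∷ᵥ p) = ∣p∣≡ΣF p

lookup-∉ : ∀ {n} {p : Subset n} {x} → x ∉ p → lookup p x ≡ false
lookup-∉ {p = p} {x} x∉p with lookup p x in e
... | true = absurd (x∉p (lookup⇒[]= x p e))
... | false = refl

Enumerates : ∀ {n} → Subset n → List (Fin n) → Set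
Enumerates S L = Unique L × (∀ {x} → x ∈ S → x ∈ₗ L) × (∀ {x} → x ∈ₗ L → x ∈ S)

members : ∀ {n} (S : Subset n) → Σ (List (Fin n)) (Enumerates S)
members {n} S = filter (_∈? S) (allFin n)
              , filter⁺ (_∈? S) {allFin n} (allFin⁺ n)
              , ∈-filter⁺ (_∈? S) (∈-allFin _)
              , (proj₂ ∘ ∈-filter⁻ (_∈? S) {xs = allFin n})

∣S∣≡length : ∀ {n} {S : Subset n} {L} → Enumerates S L → ∣ S ∣ ≡ length L
∣S∣≡length {S = S} {L} (u , to , from) = begin
    ∣ S ∣                  ≡⟨ ∣p∣≡ΣF S ⟩
    ΣF (ind ∘ lookup S)    ≡⟨ ΣF-support L _ u (λ i i∉L → cong ind (lookup-∉ (i∉L ∘ to))) ⟩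
    ΣL L (ind ∘ lookup S)  ≡⟨ ΣL-cong L (λ m → cong ind ([]=⇒lookup (from m))) ⟩
    ΣL L (λ _ → 1)         ≡⟨ ΣL-ones L ⟩
    length L               ∎
  where open ≡-Reasoning

<ᵇ-irrefl : ∀ m → (m <ᵇ m) ≡ false
<ᵇ-irrefl zero = refl
<ᵇ-irrefl (suc m) = <ᵇ-irrefl m

module Graph {n : ℕ} (G : ADMG n) where
  open ADMG G

  ∈pair⁻ : ∀ {v w x} → x ∈ pair G v w → two G v w x
  ∈pair⁻ {v} {w} m = Sum.map (x∈⁅y⁆⇒x≡y v) (x∈⁅y⁆⇒x≡y w) (x∈p∪q⁻ ⁅ v ⁆ ⁅ w ⁆ m)

  ∈pair⁺ : ∀ {v w x} → two G v w x → x ∈ pair G v w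
  ∈pair⁺ {v} {w} (inj₁ refl) = x∈p∪q⁺ (inj₁ (x∈⁅x⁆ v))
  ∈pair⁺ {v} {w} (inj₂ refl) = x∈p∪q⁺ {p = ⁅ v ⁆} (inj₂ (x∈⁅x⁆ w))

  ∈triple⁻ : ∀ {u v w x} → x ∈ triple G u v w → three G u v w x
  ∈triple⁻ {u} {v} {w} m = Sum.map (x∈⁅y⁆⇒x≡y u) ∈pair⁻ (x∈p∪q⁻ ⁅ u ⁆ (pair G v w) m)

  ∈triple⁺ : ∀ {u v w x} → three G u v w x → x ∈ triple G u v w
  ∈triple⁺ {u} (inj₁ refl) = x∈p∪q⁺ (inj₁ (x∈⁅x⁆ u))
  ∈triple⁺ {u} (inj₂ m) = x∈p∪q⁺ {p = ⁅ u ⁆} (inj₂ (∈pair⁺ m))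

  pair-≡ : ∀ {S v w} → (∀ {x} → x ∈ S → two G v w x) → v ∈ S → w ∈ S → S ≡ pair G v w
  pair-≡ {S} sub v∈S w∈S = ⊆-antisym (∈pair⁺ ∘ sub) (back ∘ ∈pair⁻)
    where
    back : ∀ {x} → two G _ _ x → x ∈ S
    back (inj₁ refl) = v∈S
    back (inj₂ refl) = w∈S

  triple-≡ : ∀ {S u v w} → (∀ {x} → x ∈ S → three G u v w x) → u ∈ S → v ∈ S → w ∈ S →
             S ≡ triple G u v w
  triple-≡ {S} sub u∈S v∈S w∈S = ⊆-antisym (∈triple⁺ ∘ sub) (back ∘ ∈triple⁻)
    where
    back : ∀ {x} → three G _ _ _ x → x ∈ S
    back (inj₁ refl) = u∈S
    back (inj₂ (inj₁ refl)) = v∈S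
    back (inj₂ (inj₂ refl)) = w∈S

  pair-swap : ∀ {v w} → pair G v w ≡ pair G w v
  pair-swap = pair-≡ (Sum.swap ∘ ∈pair⁻) (∈pair⁺ (inj₂ refl)) (∈pair⁺ (inj₁ refl))

  triple-swap₁₂ : ∀ {u v w} → triple G u v w ≡ triple G v u w
  triple-swap₁₂ = triple-≡ (swap ∘ ∈triple⁻) (∈triple⁺ (inj₂ (inj₁ refl))) (∈triple⁺ (inj₁ refl))
                           (∈triple⁺ (inj₂ (inj₂ refl)))
    where
    swap : ∀ {u v w x} → three G u v w x → three G v u w x
    swap (inj₁ e) = inj₂ (inj₁ e)
    swap (inj₂ (inj₁ e)) = inj₁ e
    swap (inj₂ (inj₂ e)) = inj₂ (inj₂ e)

  triple-swap₂₃ : ∀ {u v w} → triple G u v w ≡ triple G u w v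
  triple-swap₂₃ = triple-≡ (swap ∘ ∈triple⁻) (∈triple⁺ (inj₁ refl)) (∈triple⁺ (inj₂ (inj₂ refl)))
                           (∈triple⁺ (inj₂ (inj₁ refl)))
    where
    swap : ∀ {u v w x} → three G u v w x → three G u w v x
    swap (inj₁ e) = inj₁ e
    swap (inj₂ (inj₁ e)) = inj₂ (inj₂ e)
    swap (inj₂ (inj₂ e)) = inj₂ (inj₁ e)

  Bi-sym : ∀ {a b} → Bi G a b → Bi G b a
  Bi-sym {a} {b} = subst T (bi-sym a b)

  Adj-sym : ∀ {a b} → Adj G a b → Adj G b a
  Adj-sym (inj₁ d) = inj₂ (inj₁ d)
  Adj-sym (inj₂ (inj₁ d)) = inj₁ d
  Adj-sym (inj₂ (inj₂ e)) = inj₂ (inj₂ (Bi-sym e))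

  Bi⇒≢ : ∀ {a b} → Bi G a b → a ≢ b
  Bi⇒≢ {a} e refl = subst T (bi-irrefl a) e

  Dir⇒≢ : ∀ {a b} → Dir G a b → a ≢ b
  Dir⇒≢ {a} d refl = acyclic a a d ε

  Adj⇒adjᵇ : ∀ {a b} → Adj G a b → adjᵇ G a b ≡ true
  Adj⇒adjᵇ = Equivalence.to T-≡ ∘ Equivalence.from T-∨ ∘ Sum.map₂ (Equivalence.from T-∨)

  adjᵇ⇒Adj : ∀ {a b} → adjᵇ G a b ≡ true → Adj G a b
  adjᵇ⇒Adj = Sum.map₂ (Equivalence.to T-∨) ∘ Equivalence.to T-∨ ∘ Equivalence.from T-≡

  ¬Adj⇒adjᵇ : ∀ {a b} → ¬ Adj G a b → adjᵇ G a b ≡ false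
  ¬Adj⇒adjᵇ ¬adj = ¬-not (¬adj ∘ adjᵇ⇒Adj)

  Adj? : ∀ a b → Dec (Adj G a b)
  Adj? a b = map′ adjᵇ⇒Adj Adj⇒adjᵇ (adjᵇ G a b ≟ᵇ true)

  adjᵇ-sym : ∀ a b → adjᵇ G a b ≡ adjᵇ G b a
  adjᵇ-sym a b rewrite bi-sym a b with dir a b | dir b a
  ... | true  | true  = refl
  ... | true  | false = refl
  ... | false | true  = refl
  ... | false | false = refl

  An-mono : ∀ {P P' : VPred n} → (∀ {x} → P x → P' x) → ∀ {x} → An G P x → An G P' x
  An-mono h (w , pw , s) = w , h pw , s

  DisIn-mono : ∀ {W W' : VPred n} → (∀ {x} → W x → W' x) → ∀ {a b} → DisIn G W a b → DisIn G W' a b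
  DisIn-mono h ε = ε
  DisIn-mono h ((wa , wb , e) ◅ d) = (h wa , h wb , e) ◅ DisIn-mono h d

  DisIn-sym : ∀ {W a b} → DisIn G W a b → DisIn G W b a
  DisIn-sym = reverseStar (λ { (wx , wy , e) → wy , wx , Bi-sym e })

  DisIn⇒Dis : ∀ {W a b} → DisIn G W a b → Dis G a b
  DisIn⇒Dis ε = ε
  DisIn⇒Dis ((_ , _ , e) ◅ d) = e ◅ DisIn⇒Dis d

  tail⇒head : ∀ {H x} → Tail G H x → ∃[ h ] (h ∈ H)
  tail⇒head (inj₁ ((h , m , _) , _)) = h , m
  tail⇒head (inj₂ (_ , (h , m , _) , _)) = h , m

  -- each unordered adjacent pair {a, b} is counted once, as the ordered pair with a < b
  orderedAdj : Fin n → Fin n → ℕ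
  orderedAdj a b = if (toℕ a <ᵇ toℕ b) ∧ adjᵇ G a b then 1 else 0

  orderedAdj-diag : ∀ a → orderedAdj a a ≡ 0
  orderedAdj-diag a rewrite <ᵇ-irrefl (toℕ a) = refl

  orderedAdj-pair : ∀ a b → a ≢ b → orderedAdj a b + orderedAdj b a ≡ ind (adjᵇ G a b)
  orderedAdj-pair a b a≢b with toℕ a <ᵇ toℕ b in ab | toℕ b <ᵇ toℕ a in ba
  ... | true  | true  = absurd (<-asym (<ᵇ⇒< (toℕ a) (toℕ b) (subst T (sym ab) tt)) (<ᵇ⇒< (toℕ b) (toℕ a) (subst T (sym ba) tt)))
  ... | true  | false = +-identityʳ _
  ... | false | true  = cong ind (adjᵇ-sym b a)
  ... | false | false = absurd (a≢b (toℕ-injective (≤-antisym (≮⇒≥ (not< ba)) (≮⇒≥ (not< ab)))))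
    where
    not< : ∀ {m k} → (m <ᵇ k) ≡ false → ¬ (m < k)
    not< {m} {k} e lt = subst T e (<⇒<ᵇ lt)

  adjPairs-enum : ∀ {S L} → Enumerates S L → adjPairs G S ≡ ΣL L (λ a → ΣL L (orderedAdj a))
  adjPairs-enum {S} {L} (u , to , from) = begin
      adjPairs G S                 ≡⟨ ΣF-allPairs {n} _ ⟩
      ΣF (λ a → ΣF (restricted a))  ≡⟨ ΣF-support L _ u (λ a a∉L → ΣF-zero (outside a∉L)) ⟩
      ΣL L (λ a → ΣF (restricted a)) ≡⟨ ΣL-cong L inside ⟩
      ΣL L (λ a → ΣL L (orderedAdj a)) ∎
    where
    open ≡-Reasoning
    restricted : Fin n → Fin n → ℕ
    restricted a b = if lookup S a ∧ lookup S b ∧ (toℕ a <ᵇ toℕ b) ∧ adjᵇ G a b then 1 else 0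
    outside : ∀ {a} → a ∉ₗ L → ∀ b → restricted a b ≡ 0
    outside a∉L b rewrite lookup-∉ (a∉L ∘ to) = refl
    inside : ∀ {a} → a ∈ₗ L → ΣF (restricted a) ≡ ΣL L (orderedAdj a)
    inside {a} a∈L = trans (ΣF-support L _ u outside′) (ΣL-cong L agree)
      where
      a∈S = []=⇒lookup (from a∈L)
      outside′ : ∀ b → b ∉ₗ L → restricted a b ≡ 0
      outside′ b b∉L rewrite a∈S | lookup-∉ (b∉L ∘ to) = refl
      agree : ∀ {b} → b ∈ₗ L → restricted a b ≡ orderedAdj a b
      agree b∈L rewrite a∈S | []=⇒lookup (from b∈L) = refl

  pair-enum : ∀ {v w} → v ≢ w → Enumerates (pair G v w) (v ∷ w ∷ [])
  pair-enum v≢w = ((v≢w ∷ []) ∷ [] ∷ []) , (listed ∘ ∈pair⁻) , (∈pair⁺ ∘ unlisted)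
    where
    listed : ∀ {v w x} → two G v w x → x ∈ₗ v ∷ w ∷ []
    listed (inj₁ refl) = here refl
    listed (inj₂ refl) = there (here refl)
    unlisted : ∀ {v w x} → x ∈ₗ v ∷ w ∷ [] → two G v w x
    unlisted (here e) = inj₁ e
    unlisted (there (here e)) = inj₂ e

  triple-enum : ∀ {u v w} → u ≢ v → u ≢ w → v ≢ w → Enumerates (triple G u v w) (u ∷ v ∷ w ∷ [])
  triple-enum u≢v u≢w v≢w = ((u≢v ∷ u≢w ∷ []) ∷ (v≢w ∷ []) ∷ [] ∷ []) , (listed ∘ ∈triple⁻) , (∈triple⁺ ∘ unlisted)
    where
    listed : ∀ {u v w x} → three G u v w x → x ∈ₗ u ∷ v ∷ w ∷ []
    listed (inj₁ refl) = here refl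
    listed (inj₂ (inj₁ refl)) = there (here refl)
    listed (inj₂ (inj₂ refl)) = there (there (here refl))
    unlisted : ∀ {u v w x} → x ∈ₗ u ∷ v ∷ w ∷ [] → three G u v w x
    unlisted (here e) = inj₁ e
    unlisted (there (here e)) = inj₂ (inj₁ e)
    unlisted (there (there (here e))) = inj₂ (inj₂ e)

  pair-counts : ∀ {v w} → v ≢ w → ∣ pair G v w ∣ ≡ 2 × adjPairs G (pair G v w) ≡ ind (adjᵇ G v w)
  pair-counts {v} {w} v≢w = ∣S∣≡length (pair-enum v≢w) , trans (adjPairs-enum (pair-enum v≢w)) sum₂
    where
    sum₂ : ΣL (v ∷ w ∷ []) (λ a → ΣL (v ∷ w ∷ []) (orderedAdj a)) ≡ ind (adjᵇ G v w)
    sum₂ rewrite orderedAdj-diag v | orderedAdj-diag w =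
      trans (arith (orderedAdj v w) (orderedAdj w v)) (orderedAdj-pair v w v≢w)
      where
      arith : ∀ x y → (0 + (x + 0)) + ((y + (0 + 0)) + 0) ≡ x + y
      arith = solve-∀

  triple-counts : ∀ {u v w} → u ≢ v → u ≢ w → v ≢ w →
                  ∣ triple G u v w ∣ ≡ 3 ×
                  adjPairs G (triple G u v w) ≡ ind (adjᵇ G u v) + ind (adjᵇ G u w) + ind (adjᵇ G v w)
  triple-counts {u} {v} {w} u≢v u≢w v≢w =
    ∣S∣≡length enum , trans (adjPairs-enum enum) sum₃
    where
    enum = triple-enum u≢v u≢w v≢w
    sum₃ : ΣL (u ∷ v ∷ w ∷ []) (λ a → ΣL (u ∷ v ∷ w ∷ []) (orderedAdj a))
           ≡ ind (adjᵇ G u v) + ind (adjᵇ G u w) + ind (adjᵇ G v w)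
    sum₃ rewrite orderedAdj-diag u | orderedAdj-diag v | orderedAdj-diag w
               | sym (orderedAdj-pair u v u≢v) | sym (orderedAdj-pair u w u≢w) | sym (orderedAdj-pair v w v≢w) =
      arith (orderedAdj u v) (orderedAdj v u) (orderedAdj u w) (orderedAdj w u) (orderedAdj v w) (orderedAdj w v)
      where
      arith : ∀ a b c d e f → (0 + (a + (c + 0))) + ((b + (0 + (e + 0))) + ((d + (f + (0 + 0))) + 0))
                              ≡ (a + b) + (c + d) + (e + f)
      arith = solve-∀

  data Small (S : Subset n) : Set where
    isPair : ∀ v w → v ≢ w → S ≡ pair G v w → Small S
    isTriple : ∀ u v w → u ≢ v → u ≢ w → v ≢ w → S ≡ triple G u v w → Small S

  small : ∀ S → 2 ≤ ∣ S ∣ → ∣ S ∣ ≤ 3 → Small S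
  small S lo hi with members S
  ... | L , enum = byLength L enum (subst (2 ≤_) (∣S∣≡length enum) lo) (subst (_≤ 3) (∣S∣≡length enum) hi)
    where
    byLength : ∀ L → Enumerates S L → 2 ≤ length L → length L ≤ 3 → Small S
    byLength [] _ () _
    byLength (_ ∷ []) _ (s≤s ()) _
    byLength (v ∷ w ∷ []) ((v≢ ∷ []) ∷ _ , to , from) _ _ =
      isPair v w v≢ (pair-≡ (two-of ∘ to) (from (here refl)) (from (there (here refl))))
      where
      two-of : ∀ {x} → x ∈ₗ v ∷ w ∷ [] → two G v w x
      two-of (here e) = inj₁ e
      two-of (there (here e)) = inj₂ e
    byLength (u ∷ v ∷ w ∷ []) ((u≢v ∷ u≢w ∷ []) ∷ (v≢w ∷ []) ∷ _ , to , from) _ _ =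
      isTriple u v w u≢v u≢w v≢w
        (triple-≡ (three-of ∘ to) (from (here refl)) (from (there (here refl))) (from (there (there (here refl)))))
      where
      three-of : ∀ {x} → x ∈ₗ u ∷ v ∷ w ∷ [] → three G u v w x
      three-of (here e) = inj₁ e
      three-of (there (here e)) = inj₂ (inj₁ e)
      three-of (there (there (here e))) = inj₂ (inj₂ e)
    byLength (_ ∷ _ ∷ _ ∷ _ ∷ _) _ _ (s≤s (s≤s (s≤s ())))

OneOrTwo : ℕ → Set
OneOrTwo k = k ≡ 1 ⊎ k ≡ 2

oneOrTwo-first : ∀ y z → ¬ (y ≡ true × z ≡ true) → OneOrTwo (ind true + ind y + ind z)
oneOrTwo-first true  true  ¬both = absurd (¬both (refl , refl))
oneOrTwo-first true  false _     = inj₂ refl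
oneOrTwo-first false true  _     = inj₂ refl
oneOrTwo-first false false _     = inj₁ refl

oneOrTwo⇒¬all : ∀ {x y z} → OneOrTwo (ind x + ind y + ind z) → ¬ (x ≡ true × y ≡ true × z ≡ true)
oneOrTwo⇒¬all (inj₁ ()) (refl , refl , refl)
oneOrTwo⇒¬all (inj₂ ()) (refl , refl , refl)

oneOrTwo⇒some : ∀ x y z → OneOrTwo (ind x + ind y + ind z) → x ≡ true ⊎ y ≡ true ⊎ z ≡ true
oneOrTwo⇒some true  _     _     _ = inj₁ refl
oneOrTwo⇒some false true  _     _ = inj₂ (inj₁ refl)
oneOrTwo⇒some false false true  _ = inj₂ (inj₂ refl)
oneOrTwo⇒some false false false (inj₁ ())
oneOrTwo⇒some false false false (inj₂ ())

oneOrTwo⇒true : ∀ x → OneOrTwo (ind x) → x ≡ true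
oneOrTwo⇒true true  _ = refl
oneOrTwo⇒true false (inj₁ ())
oneOrTwo⇒true false (inj₂ ())

size₂ : ∀ {k} → k ≡ 2 → 2 ≤ k × k ≤ 3
size₂ refl = s≤s (s≤s z≤n) , s≤s (s≤s z≤n)

size₃ : ∀ {k} → k ≡ 3 → 2 ≤ k × k ≤ 3
size₃ refl = s≤s (s≤s z≤n) , s≤s (s≤s (s≤s z≤n))

-- A₁(G) ⊆ S̃₃(G): for each clause, a head and a subset of its tail.

module Forward {n : ℕ} (G : ADMG n) (ancestral : Ancestral G) where
  open ADMG G
  open Graph G

  singleton-head : ∀ v → IsHead G ⁅ v ⁆
  singleton-head v = (λ h h' m m' _ → trans (x∈⁅y⁆⇒x≡y v m) (sym (x∈⁅y⁆⇒x≡y v m'))) , district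
    where
    district : OneDistrict G ⁅ v ⁆
    district h h' m m' with x∈⁅y⁆⇒x≡y v m | x∈⁅y⁆⇒x≡y v m'
    ... | refl | refl = ε

  parents-in-tail : ∀ {v} A → (∀ {x} → x ∈ A → Dir G x v) → ∀ x → x ∈ A → Tail G ⁅ v ⁆ x
  parents-in-tail {v} A parent x m = inj₂ (v , (v , x∈⁅x⁆ v , ε) , parent m)

  parent-of : ∀ {u v x} → x ≡ u → Dir G u v → Dir G x v
  parent-of refl d = d

  empty-tail : ∀ H x → x ∈ ⊥ → Tail G H x
  empty-tail H x m = absurd (∉⊥ m)

  -- by ancestrality neither end of v ↔ w is an ancestor of the other, so {v, w} is a head
  sibling-head : ∀ {v w} → Bi G v w → IsHead G (pair G v w)
  sibling-head {v} {w} v↔w = barren , district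
    where
    barren : Barren G (pair G v w)
    barren h h' m m' s with ∈pair⁻ m | ∈pair⁻ m'
    ... | inj₁ refl | inj₁ refl = refl
    ... | inj₂ refl | inj₂ refl = refl
    ... | inj₁ refl | inj₂ refl = absurd (ancestral w v (Bi-sym v↔w) s)
    ... | inj₂ refl | inj₁ refl = absurd (ancestral v w v↔w s)
    v⇝w : DisIn G (An G (_∈ pair G v w)) v w
    v⇝w = ((v , ∈pair⁺ (inj₁ refl) , ε) , (w , ∈pair⁺ (inj₂ refl) , ε) , v↔w) ◅ ε
    district : OneDistrict G (pair G v w)
    district h h' m m' with ∈pair⁻ m | ∈pair⁻ m'
    ... | inj₁ refl | inj₁ refl = ε
    ... | inj₂ refl | inj₂ refl = ε
    ... | inj₁ refl | inj₂ refl = v⇝w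
    ... | inj₂ refl | inj₁ refl = DisIn-sym v⇝w

  T⊆tail : ∀ {v w z} → TSet G v w z → Tail G (pair G v w) z
  T⊆tail {v} {w} (inj₁ d , z≢v , z≢w) =
    inj₁ ((v , ∈pair⁺ (inj₁ refl) , DisIn-mono (An-mono ∈pair⁺) d) , [ z≢v , z≢w ] ∘ ∈pair⁻)
  T⊆tail {v} (inj₂ (d , dd , z→d) , _ , _) =
    inj₂ (d , (v , ∈pair⁺ (inj₁ refl) , DisIn-mono (An-mono ∈pair⁺) dd) , z→d)

  -- the triple of clause (e) is a head: barren since z is neither an ancestor nor a
  -- descendant of v, w, and one district since v ↔ w and z ∈ dis_{an({v,w,z})}(v)
  clause-e-head : ∀ {v w z} → Bi G v w → ¬ An G (two G v w) z → ¬ De G (two G v w) z →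
                  DisIn G (An G (three G v w z)) v z → IsHead G (triple G v w z)
  clause-e-head {v} {w} {z} v↔w ¬an ¬de dvz = barren , district
    where
    barren : Barren G (triple G v w z)
    barren h h' m m' s with ∈triple⁻ m | ∈triple⁻ m'
    ... | inj₁ refl | inj₁ refl = refl
    ... | inj₂ (inj₁ refl) | inj₂ (inj₁ refl) = refl
    ... | inj₂ (inj₂ refl) | inj₂ (inj₂ refl) = refl
    ... | inj₁ refl | inj₂ (inj₁ refl) = absurd (ancestral w v (Bi-sym v↔w) s)
    ... | inj₂ (inj₁ refl) | inj₁ refl = absurd (ancestral v w v↔w s)
    ... | inj₂ (inj₂ refl) | inj₁ refl = absurd (¬an (v , inj₁ refl , s))
    ... | inj₂ (inj₂ refl) | inj₂ (inj₁ refl) = absurd (¬an (w , inj₂ refl , s))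
    ... | inj₁ refl | inj₂ (inj₂ refl) = absurd (¬de (v , inj₁ refl , s))
    ... | inj₂ (inj₁ refl) | inj₂ (inj₂ refl) = absurd (¬de (w , inj₂ refl , s))
    v~w : DisIn G (An G (_∈ triple G v w z)) v w
    v~w = ((v , ∈triple⁺ (inj₁ refl) , ε) , (w , ∈triple⁺ (inj₂ (inj₁ refl)) , ε) , v↔w) ◅ ε
    v~z : DisIn G (An G (_∈ triple G v w z)) v z
    v~z = DisIn-mono (An-mono ∈triple⁺) dvz
    district : OneDistrict G (triple G v w z)
    district h h' m m' with ∈triple⁻ m | ∈triple⁻ m'
    ... | inj₁ refl | inj₁ refl = ε
    ... | inj₂ (inj₁ refl) | inj₂ (inj₁ refl) = ε
    ... | inj₂ (inj₂ refl) | inj₂ (inj₂ refl) = ε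
    ... | inj₁ refl | inj₂ (inj₁ refl) = v~w
    ... | inj₂ (inj₁ refl) | inj₁ refl = DisIn-sym v~w
    ... | inj₁ refl | inj₂ (inj₂ refl) = v~z
    ... | inj₂ (inj₂ refl) | inj₁ refl = DisIn-sym v~z
    ... | inj₂ (inj₁ refl) | inj₂ (inj₂ refl) = DisIn-sym v~w ◅◅ v~z
    ... | inj₂ (inj₂ refl) | inj₂ (inj₁ refl) = DisIn-sym v~z ◅◅ v~w

  sibling-triple-adjPairs : ∀ {v w z} → Bi G v w → z ≢ v → z ≢ w → ¬ (Adj G z v × Adj G z w) →
                            OneOrTwo (adjPairs G (triple G v w z))
  sibling-triple-adjPairs {v} {w} {z} v↔w z≢v z≢w ¬both =
    subst OneOrTwo (sym count) (oneOrTwo-first _ _ λ (e₁ , e₂) → ¬both (Adj-sym (adjᵇ⇒Adj e₁) , Adj-sym (adjᵇ⇒Adj e₂)))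
    where
    count : adjPairs G (triple G v w z) ≡ ind true + ind (adjᵇ G v z) + ind (adjᵇ G w z)
    count rewrite proj₂ (triple-counts (Bi⇒≢ v↔w) (≢-sym z≢v) (≢-sym z≢w))
                | Adj⇒adjᵇ {v} {w} (inj₂ (inj₂ v↔w)) = refl

  clause-a : ∀ {v w} → Dir G w v → InS̃3 G (pair G v w)
  clause-a {v} {w} w→v =
    ((⁅ v ⁆ , ⁅ w ⁆ , singleton-head v , parents-in-tail ⁅ w ⁆ (λ m → parent-of (x∈⁅y⁆⇒x≡y w m) w→v) , refl)
    , size₂ (proj₁ counts))
    , inj₁ (trans (proj₂ counts) (cong ind (Adj⇒adjᵇ {v} {w} (inj₂ (inj₁ w→v)))))
    where counts = pair-counts (≢-sym (Dir⇒≢ w→v))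

  clause-b : ∀ {v w z} → w ≢ z → Dir G w v → Dir G z v → ¬ Adj G z w → InS̃3 G (triple G v w z)
  clause-b {v} {w} {z} w≢z w→v z→v ¬adj =
    ((⁅ v ⁆ , pair G w z , singleton-head v , parents-in-tail (pair G w z) (parent ∘ ∈pair⁻) , refl)
    , size₃ (proj₁ counts))
    , inj₂ adjacentPairs
    where
    counts = triple-counts (≢-sym (Dir⇒≢ w→v)) (≢-sym (Dir⇒≢ z→v)) w≢z
    parent : ∀ {x} → two G w z x → Dir G x v
    parent (inj₁ x≡w) = parent-of x≡w w→v
    parent (inj₂ x≡z) = parent-of x≡z z→v
    adjacentPairs : adjPairs G (triple G v w z) ≡ 2
    adjacentPairs rewrite proj₂ counts | Adj⇒adjᵇ {v} {w} (inj₂ (inj₁ w→v)) | Adj⇒adjᵇ {v} {z} (inj₂ (inj₁ z→v))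
                        | ¬Adj⇒adjᵇ {w} {z} (¬adj ∘ Adj-sym) = refl

  clause-c : ∀ {v w} → Bi G v w → InS̃3 G (pair G v w)
  clause-c {v} {w} v↔w =
    ((pair G v w , ⊥ , sibling-head v↔w , empty-tail _ , sym (∪-identityʳ _)) , size₂ (proj₁ counts))
    , inj₁ (trans (proj₂ counts) (cong ind (Adj⇒adjᵇ {v} {w} (inj₂ (inj₂ v↔w)))))
    where counts = pair-counts (Bi⇒≢ v↔w)

  clause-d : ∀ {v w z} → Bi G v w → TSet G v w z → ¬ (Adj G z v × Adj G z w) → InS̃3 G (triple G v w z)
  clause-d {v} {w} {z} v↔w t@(_ , z≢v , z≢w) ¬both =
    ((pair G v w , ⁅ z ⁆ , sibling-head v↔w , tail-z , sym (∪-assoc ⁅ v ⁆ ⁅ w ⁆ ⁅ z ⁆))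
    , size₃ (proj₁ (triple-counts (Bi⇒≢ v↔w) (≢-sym z≢v) (≢-sym z≢w))))
    , sibling-triple-adjPairs v↔w z≢v z≢w ¬both
    where
    tail-z : ∀ x → x ∈ ⁅ z ⁆ → Tail G (pair G v w) x
    tail-z x m with x∈⁅y⁆⇒x≡y z m
    ... | refl = T⊆tail t

  clause-e : ∀ {v w z} → Bi G v w → ¬ An G (two G v w) z → ¬ De G (two G v w) z →
             ¬ (Adj G z v × Adj G z w) → DisIn G (An G (three G v w z)) v z → InS̃3 G (triple G v w z)
  clause-e {v} {w} {z} v↔w ¬an ¬de ¬both dvz =
    ((triple G v w z , ⊥ , clause-e-head v↔w ¬an ¬de dvz , empty-tail _ , sym (∪-identityʳ _))
    , size₃ (proj₁ (triple-counts (Bi⇒≢ v↔w) (≢-sym z≢v) (≢-sym z≢w))))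
    , sibling-triple-adjPairs v↔w z≢v z≢w ¬both
    where
    z≢v : z ≢ v
    z≢v refl = ¬an (z , inj₁ refl , ε)
    z≢w : z ≢ w
    z≢w refl = ¬an (z , inj₂ refl , ε)

  forward : ∀ S → InA1 G S → InS̃3 G S
  forward S (inj₁ (v , w , w→v , refl)) = clause-a w→v
  forward S (inj₂ (inj₁ (v , w , z , w≢z , w→v , z→v , ¬adj , refl))) = clause-b w≢z w→v z→v ¬adj
  forward S (inj₂ (inj₂ (inj₁ (v , w , v↔w , refl)))) = clause-c v↔w
  forward S (inj₂ (inj₂ (inj₂ (inj₁ (v , w , z , v↔w , t , ¬both , refl))))) = clause-d v↔w t ¬both
  forward S (inj₂ (inj₂ (inj₂ (inj₂ (v , w , z , v↔w , _ , _ , ¬an , ¬de , ¬both , dvz , refl))))) =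
    clause-e v↔w ¬an ¬de ¬both dvz

-- S̃₃(G) ⊆ A₁(G): S = H ∪ A is an explicit pair or triple; split on which of its
-- vertices belong to the head H.

module Backward {n : ℕ} (G : ADMG n) (mag : IsMAG G) where
  open ADMG G
  open Graph G

  ancestral : Ancestral G
  ancestral = proj₂ mag

  module _ {S H A : Subset n} (barren : Barren G H) (oneDistrict : OneDistrict G H)
           (tails : ∀ x → x ∈ A → Tail G H x) (S≡H∪A : S ≡ H ∪ A) where

    H⊆S : ∀ {x} → x ∈ H → x ∈ S
    H⊆S m = subst (_ ∈_) (sym S≡H∪A) (x∈p∪q⁺ (inj₁ m))

    outside-head : ∀ {x} → x ∈ S → x ∉ H → Tail G H x
    outside-head {x} m x∉H with x∈p∪q⁻ H A (subst (_ ∈_) S≡H∪A m)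
    ... | inj₁ x∈H = absurd (x∉H x∈H)
    ... | inj₂ x∈A = tails x x∈A

    head-in-S : ∀ {x} → x ∈ S → ∃[ h ] (h ∈ H)
    head-in-S {x} m with x ∈? H
    ... | yes x∈H = x , x∈H
    ... | no x∉H = tail⇒head (outside-head m x∉H)

    -- two adjacent head vertices are joined by ↔, as H is barren
    head-edge : ∀ {a b} → a ∈ H → b ∈ H → a ≢ b → Adj G a b → Bi G a b
    head-edge a∈H b∈H a≢b (inj₁ a→b) = absurd (a≢b (barren _ _ a∈H b∈H (a→b ◅ ε)))
    head-edge a∈H b∈H a≢b (inj₂ (inj₁ b→a)) = absurd (a≢b (sym (barren _ _ b∈H a∈H (b→a ◅ ε))))
    head-edge a∈H b∈H a≢b (inj₂ (inj₂ a↔b)) = a↔b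

    -- if h is the only head vertex then, by ancestrality, its district in G_{an(H)} is {h}
    lone-head-district : ∀ {h h' y} → (∀ {x} → x ∈ H → x ≡ h) → h' ∈ H → DisIn G (An G (_∈ H)) h' y → y ≡ h
    lone-head-district only-h m ε = only-h m
    lone-head-district only-h m ((_ , (h'' , m'' , s) , h'↔u) ◅ _) with only-h m | only-h m''
    ... | refl | refl = absurd (ancestral _ _ h'↔u s)

    lone-head-tail : ∀ {h t} → (∀ {x} → x ∈ H → x ≡ h) → t ∉ H → Tail G H t → Dir G t h
    lone-head-tail only-h t∉H (inj₁ ((h' , m , d) , _)) with lone-head-district only-h m d
    ... | refl = absurd (t∉H (subst (_∈ H) (only-h m) m))
    lone-head-tail only-h t∉H (inj₂ (d , (h' , m , dd) , t→d)) with lone-head-district only-h m dd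
    ... | refl = t→d

    module Pair {p q : Fin n} (p≢q : p ≢ q) (S≡pq : S ≡ pair G p q) where

      p∈S : p ∈ S
      p∈S = subst (p ∈_) (sym S≡pq) (∈pair⁺ (inj₁ refl))

      H-members : ∀ {x} → x ∈ H → two G p q x
      H-members = ∈pair⁻ ∘ subst (_ ∈_) S≡pq ∘ H⊆S

      adjacent : OneOrTwo (adjPairs G S) → Adj G p q
      adjacent adj12 = adjᵇ⇒Adj (oneOrTwo⇒true _ (subst OneOrTwo (trans (cong (adjPairs G) S≡pq) (proj₂ (pair-counts p≢q))) adj12))

      -- with p the only head vertex, q is a tail vertex and hence a parent of p
      parent-of-head : q ∉ H → Dir G q p
      parent-of-head q∉H = lone-head-tail only-p q∉H (outside-head q∈S q∉H)
        where
        q∈S = subst (q ∈_) (sym S≡pq) (∈pair⁺ (inj₂ refl))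
        only-p : ∀ {x} → x ∈ H → x ≡ p
        only-p m with H-members m
        ... | inj₁ x≡p = x≡p
        ... | inj₂ refl = absurd (q∉H m)

      some-head : p ∉ H → q ∉ H → Empty
      some-head p∉H q∉H with head-in-S p∈S
      ... | h , h∈H with H-members h∈H
      ...   | inj₁ refl = p∉H h∈H
      ...   | inj₂ refl = q∉H h∈H

    -- S = {p, q}: two head vertices give clause (c), one gives clause (a)
    pair-case : ∀ {p q} → p ≢ q → S ≡ pair G p q → OneOrTwo (adjPairs G S) → InA1 G S
    pair-case {p} {q} p≢q S≡pq adj12 with p ∈? H | q ∈? H
    ... | yes p∈H | yes q∈H =
      inj₂ (inj₂ (inj₁ (p , q , head-edge p∈H q∈H p≢q (Pair.adjacent p≢q S≡pq adj12) , S≡pq)))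
    ... | yes _ | no q∉H = inj₁ (p , q , Pair.parent-of-head p≢q S≡pq q∉H , S≡pq)
    ... | no p∉H | yes _ = inj₁ (q , p , Pair.parent-of-head (≢-sym p≢q) S≡qp p∉H , S≡qp)
      where S≡qp = trans S≡pq pair-swap
    ... | no p∉H | no q∉H = absurd (Pair.some-head p≢q S≡pq p∉H q∉H)

    module Triple {a b c : Fin n} (a≢b : a ≢ b) (a≢c : a ≢ c) (b≢c : b ≢ c) (S≡abc : S ≡ triple G a b c)
                  (adj12 : OneOrTwo (adjPairs G S)) where

      member : ∀ {x} → three G a b c x → x ∈ S
      member t = subst (_ ∈_) (sym S≡abc) (∈triple⁺ t)

      H-members : ∀ {x} → x ∈ H → three G a b c x
      H-members = ∈triple⁻ ∘ subst (_ ∈_) S≡abc ∘ H⊆S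

      adjacencies : OneOrTwo (ind (adjᵇ G a b) + ind (adjᵇ G a c) + ind (adjᵇ G b c))
      adjacencies = subst OneOrTwo (trans (cong (adjPairs G) S≡abc) (proj₂ (triple-counts a≢b a≢c b≢c))) adj12

      not-both : Adj G a b → ¬ (Adj G c a × Adj G c b)
      not-both ab (ca , cb) = oneOrTwo⇒¬all adjacencies (Adj⇒adjᵇ ab , Adj⇒adjᵇ (Adj-sym ca) , Adj⇒adjᵇ (Adj-sym cb))

      -- head {a}: b and c are non-adjacent parents of a, clause (b)
      one-head : a ∈ H → b ∉ H → c ∉ H → InA1 G S
      one-head a∈H b∉H c∉H = inj₂ (inj₁ (a , b , c , b≢c , b→a , c→a , ¬adj , S≡abc))
        where
        only-a : ∀ {x} → x ∈ H → x ≡ a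
        only-a m with H-members m
        ... | inj₁ x≡a = x≡a
        ... | inj₂ (inj₁ refl) = absurd (b∉H m)
        ... | inj₂ (inj₂ refl) = absurd (c∉H m)
        b→a = lone-head-tail only-a b∉H (outside-head (member (inj₂ (inj₁ refl))) b∉H)
        c→a = lone-head-tail only-a c∉H (outside-head (member (inj₂ (inj₂ refl))) c∉H)
        ¬adj : ¬ Adj G c b
        ¬adj cb = oneOrTwo⇒¬all adjacencies
          (Adj⇒adjᵇ {a} {b} (inj₂ (inj₁ b→a)) , Adj⇒adjᵇ {a} {c} (inj₂ (inj₁ c→a)) , Adj⇒adjᵇ (Adj-sym cb))

      H-members-ab : c ∉ H → ∀ {x} → x ∈ H → two G a b x
      H-members-ab c∉H m with H-members m
      ... | inj₁ x≡a = inj₁ x≡a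
      ... | inj₂ (inj₁ x≡b) = inj₂ x≡b
      ... | inj₂ (inj₂ refl) = absurd (c∉H m)

      -- head {a, b}: a ↔ b by the inducing-path lemma, and c ∈ T(a, b), clause (d)
      two-heads : a ∈ H → b ∈ H → c ∉ H → InA1 G S
      two-heads a∈H b∈H c∉H with Adj? a b
      ... | no ¬ab = absurd (co-district⇒adjacent G (proj₁ mag) a≢b a~b ¬ab)
        where a~b = DisIn-mono (An-mono (H-members-ab c∉H)) (oneDistrict a b a∈H b∈H)
      ... | yes ab = inj₂ (inj₂ (inj₂ (inj₁ (a , b , c , a↔b , c∈T , not-both ab , S≡abc))))
        where
        a↔b = head-edge a∈H b∈H a≢b ab
        within = H-members-ab c∉H
        -- dis_{an(H)}(H) ⊆ dis_{an({a,b})}(a), using a ↔ b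
        district-of-a : ∀ {y} → DisInSet G (An G (_∈ H)) (_∈ H) y → DisIn G (An G (two G a b)) a y
        district-of-a (h , m , d) with within m
        ... | inj₁ refl = DisIn-mono (An-mono within) d
        ... | inj₂ refl = ((a , inj₁ refl , ε) , (b , inj₂ refl , ε) , a↔b) ◅ DisIn-mono (An-mono within) d
        c∈T : TSet G a b c
        c∈T with outside-head (member (inj₂ (inj₂ refl))) c∉H
        ... | inj₁ (d , _) = inj₁ (district-of-a d) , ≢-sym a≢c , ≢-sym b≢c
        ... | inj₂ (x , d , c→x) = inj₂ (x , district-of-a d , c→x) , ≢-sym a≢c , ≢-sym b≢c

      -- head {a, b, c} with a – b adjacent (hence a ↔ b): clause (e)
      three-heads : a ∈ H → b ∈ H → c ∈ H → Adj G a b → InA1 G S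
      three-heads a∈H b∈H c∈H ab =
        inj₂ (inj₂ (inj₂ (inj₂ (a , b , c , a↔b , c∈sib , DisIn⇒Dis a~c , ¬an , ¬de , not-both ab
                              , DisIn-mono (An-mono H-members) a~c , S≡abc))))
        where
        a↔b = head-edge a∈H b∈H a≢b ab
        a~c : DisIn G (An G (_∈ H)) a c
        a~c = oneDistrict a c a∈H c∈H
        -- the last edge u ↔ c of the district path has u ∈ an(H) ∖ an(c) ⊆ an({a,b})
        sibling : ∀ {y} → DisIn G (An G (_∈ H)) c y → y ≡ a → Sib G (An G (two G a b)) c
        sibling ε refl = absurd (a≢c refl)
        sibling ((_ , (h , m , u⇝h) , c↔u) ◅ _) _ with H-members m
        ... | inj₁ refl = _ , (a , inj₁ refl , u⇝h) , c↔u
        ... | inj₂ (inj₁ refl) = _ , (b , inj₂ refl , u⇝h) , c↔u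
        ... | inj₂ (inj₂ refl) = absurd (ancestral _ _ c↔u u⇝h)
        c∈sib = sibling (DisIn-sym a~c) refl
        ¬an : ¬ An G (two G a b) c
        ¬an (_ , inj₁ refl , c⇝a) = a≢c (sym (barren c a c∈H a∈H c⇝a))
        ¬an (_ , inj₂ refl , c⇝b) = b≢c (sym (barren c b c∈H b∈H c⇝b))
        ¬de : ¬ De G (two G a b) c
        ¬de (_ , inj₁ refl , a⇝c) = a≢c (barren a c a∈H c∈H a⇝c)
        ¬de (_ , inj₂ refl , b⇝c) = b≢c (barren b c b∈H c∈H b⇝c)

      no-head : a ∉ H → b ∉ H → c ∉ H → Empty
      no-head a∉H b∉H c∉H with head-in-S (member (inj₁ refl))
      ... | h , h∈H with H-members h∈H
      ...   | inj₁ refl = a∉H h∈H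
      ...   | inj₂ (inj₁ refl) = b∉H h∈H
      ...   | inj₂ (inj₂ refl) = c∉H h∈H

    -- S = {p, q, r}: reorder so that the head vertices come first
    triple-case : ∀ {p q r} → p ≢ q → p ≢ r → q ≢ r → S ≡ triple G p q r → OneOrTwo (adjPairs G S) → InA1 G S
    triple-case {p} {q} {r} p≢q p≢r q≢r S≡pqr adj12 with p ∈? H | q ∈? H | r ∈? H
    ... | yes p∈H | yes q∈H | yes r∈H with oneOrTwo⇒some _ _ _ (Triple.adjacencies p≢q p≢r q≢r S≡pqr adj12)
    ...   | inj₁ pq = Triple.three-heads p≢q p≢r q≢r S≡pqr adj12 p∈H q∈H r∈H (adjᵇ⇒Adj pq)
    ...   | inj₂ (inj₁ pr) = Triple.three-heads p≢r p≢q (≢-sym q≢r) S≡prq adj12 p∈H r∈H q∈H (adjᵇ⇒Adj pr)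
      where S≡prq = trans S≡pqr triple-swap₂₃
    ...   | inj₂ (inj₂ qr) = Triple.three-heads q≢r (≢-sym p≢q) (≢-sym p≢r) S≡qrp adj12 q∈H r∈H p∈H (adjᵇ⇒Adj qr)
      where S≡qrp = trans S≡pqr (trans triple-swap₁₂ triple-swap₂₃)
    triple-case p≢q p≢r q≢r S≡pqr adj12 | yes p∈H | yes q∈H | no r∉H =
      Triple.two-heads p≢q p≢r q≢r S≡pqr adj12 p∈H q∈H r∉H
    triple-case p≢q p≢r q≢r S≡pqr adj12 | yes p∈H | no q∉H | yes r∈H =
      Triple.two-heads p≢r p≢q (≢-sym q≢r) (trans S≡pqr triple-swap₂₃) adj12 p∈H r∈H q∉H
    triple-case p≢q p≢r q≢r S≡pqr adj12 | no p∉H | yes q∈H | yes r∈H =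
      Triple.two-heads q≢r (≢-sym p≢q) (≢-sym p≢r) (trans S≡pqr (trans triple-swap₁₂ triple-swap₂₃)) adj12 q∈H r∈H p∉H
    triple-case p≢q p≢r q≢r S≡pqr adj12 | yes p∈H | no q∉H | no r∉H =
      Triple.one-head p≢q p≢r q≢r S≡pqr adj12 p∈H q∉H r∉H
    triple-case p≢q p≢r q≢r S≡pqr adj12 | no p∉H | yes q∈H | no r∉H =
      Triple.one-head (≢-sym p≢q) q≢r p≢r (trans S≡pqr triple-swap₁₂) adj12 q∈H p∉H r∉H
    triple-case p≢q p≢r q≢r S≡pqr adj12 | no p∉H | no q∉H | yes r∈H =
      Triple.one-head (≢-sym p≢r) (≢-sym q≢r) p≢q (trans S≡pqr (trans triple-swap₂₃ triple-swap₁₂)) adj12 r∈H p∉H q∉H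
    triple-case p≢q p≢r q≢r S≡pqr adj12 | no p∉H | no q∉H | no r∉H =
      absurd (Triple.no-head p≢q p≢r q≢r S≡pqr adj12 p∉H q∉H r∉H)

  backward : ∀ S → InS̃3 G S → InA1 G S
  backward S (((H , A , (barren , oneDistrict) , tails , S≡H∪A) , lo , hi) , adj12) with small S lo hi
  ... | isPair v w v≢w S≡vw = pair-case barren oneDistrict tails S≡H∪A v≢w S≡vw adj12
  ... | isTriple u v w u≢v u≢w v≢w S≡uvw = triple-case barren oneDistrict tails S≡H∪A u≢v u≢w v≢w S≡uvw adj12

proposition4p1 : (n : ℕ) (G : ADMG n) → IsMAG G →
                 (S : Subset n) → (InA1 G S ⇔ InS̃3 G S)
proposition4p1 n G mag S = mk⇔ (Forward.forward G (proj₂ mag) S) (Backward.backward G mag S)
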